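{- Let $k\ge2$, $n=2^k$, and consider the RBO receiver with data as in the context. If $t''=s$, then for every $i\in[[0,\mathrm{last}-2]]$, $\left|\bigcup_{t\in Y_{i+1}}U_t\right|\le\max\{l_{i+1}-l_i,\,2\}$.
   Context: $[[a,b]]=\{x\in\mathbb Z: a\le x\le b\}$. For an integer $x$, $\mathrm{rev}_k(x)$ is the integer in $[[0,2^k-1]]$ whose $k$-bit binary representation is the reversal of the $k$-bit binary representation of $x\bmod 2^k$. RBO protocol: real keys $\kappa_0\le\dots\le\kappa_{n-1}$; at every time slot $t=0,1,2,\dots$ the broadcaster transmits $\kappa_{\mathrm{rev}_k(t)}$. A receiver with query reals $-\infty<\kappa'\le\kappa''<+\infty$ starts at time slot $s\in[[0,n-1]]$ with $\mathrm{lb}=0$, $\mathrm{ub}=n-1$, and at each slot $t\ge s$: if $\mathrm{lb}\le\mathrm{rev}_k(t)\le\mathrm{ub}$ it receives $\kappa=\kappa_{\mathrm{rev}_k(t)}$; if $\kappa<\kappa'$ it sets $\mathrm{lb}:=\mathrm{rev}_k(t)+1$; if $\kappa''<\kappa$ it sets $\mathrm{ub}:=\mathrm{rev}_k(t)-1$. Let $\mathrm{ub}_t$ be the value of $\mathrm{ub}$ just before time slot $t$ (so $\mathrm{ub}_t=n-1$ for $t\le s$), and for $t\ge s$ let $U_t=\{\mathrm{ub}_{t+1}+1\}\setminus\{\mathrm{ub}_t+1\}$. Let $t''=\min\{t\in[[s,s+n-1]]:\mathrm{ub}_{t+1}+1\le n-1\}$. Define $t_0=s$ and for $i\ge0$: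 $l_i=\max\{l\in[[0,k]]:t_i\equiv0\pmod{2^l}\}$, $t_{i+1}=t_i+2^{l_i}$, $Y_i=[[t_i,t_i+2^{l_i}-1]]$; $\mathrm{last}=\min\{i\ge0:l_i=k\}$. -}

module Defs where

import Level
open Level using (Level)
open import Data.Nat as ℕ using (ℕ; zero; suc; _^_; _%_; _/_; _+_; _*_)
open import Data.Nat.Divisibility using (_∣?_)
open import Data.Integer as ℤ using (ℤ; +_; 0ℤ; 1ℤ)
open import Data.Bool using (if_then_else_; _∧_)
open import Data.List using (List; []; _∷_; map; concatMap; upTo; length; deduplicate)
open import Data.Product using (_×_; _,_; proj₂)
open import Data.Sum using (_⊎_)
open import Relation.Binary.Bundles using (StrictTotalOrder)
open import Relation.Nullary.Decidable using (does)

-- rev k x : reversal of the k-bit binary representation of (x mod 2^k).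
rev : ℕ → ℕ → ℕ
rev zero    x = 0
rev (suc k) x = (x % 2) * 2 ^ k + rev k (x / 2)

lmax : ℕ → ℕ → ℕ
lmax zero    t = 0
lmax (suc l) t = if does (2 ^ suc l ∣? t) then suc l else lmax l t

-- The RBO receiver, for keys in an arbitrary strict total order
-- (the paper's keys are reals; only comparisons are used).
module RBO {a ℓ₁ ℓ₂ : Level} (O : StrictTotalOrder a ℓ₁ ℓ₂)
           (k : ℕ) (κ : ℕ → StrictTotalOrder.Carrier O)
           (κ' κ'' : StrictTotalOrder.Carrier O) (s : ℕ) where
  open StrictTotalOrder O renaming (Carrier to A)

  n : ℕ
  n = 2 ^ k

  -- (lb , ub)
  State : Set
  State = ℤ × ℤ

  init : State
  init = 0ℤ , (+ n ℤ.- 1ℤ)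

  step : ℕ → State → State
  step t (lb , ub) =
    if does (lb ℤ.≤? r) ∧ does (r ℤ.≤? ub)
    then (if does (κr <? κ')
          then (r ℤ.+ 1ℤ , ub)
          else (if does (κ'' <? κr) then (lb , r ℤ.- 1ℤ) else (lb , ub)))
    else (lb , ub)
    where
      r : ℤ
      r = + rev k t
      κr : A
      κr = κ (rev k t)

  -- state just before time slot t
  state : ℕ → State
  state zero    = init
  state (suc t) = if does (t ℕ.<? s) then init else step t (state t)

  ub : ℕ → ℤ
  ub t = proj₂ (state t)

  -- U_t = {ub_{t+1}+1} \ {ub_t+1}, as a list
  U : ℕ → List ℤ
  U t = if does (ub (suc t) ℤ.≟ ub t) then [] else (ub (suc t) ℤ.+ 1ℤ ∷ [])

  ts : ℕ → ℕ
  ls : ℕ → ℕ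
  ts zero    = s
  ts (suc i) = ts i + 2 ^ ls i
  ls i = lmax k (ts i)

  Y : ℕ → List ℕ
  Y i = map (λ j → ts i + j) (upTo (2 ^ ls i))

  cardUnionU : ℕ → ℕ
  cardUnionU i = length (deduplicate ℤ._≟_ (concatMap U (Y i)))

module _ {a ℓ₁ ℓ₂ : Level} (O : StrictTotalOrder a ℓ₁ ℓ₂) where
  open StrictTotalOrder O renaming (Carrier to A)

  LeO : A → A → Set (ℓ₁ Level.⊔ ℓ₂)
  LeO x y = x < y ⊎ x ≈ y

-- On the block Y_{i+1} = [[t_{i+1}, t_{i+1} + 2^L − 1]], where t_{i+1} = (2T+1)·2^L and L = l_{i+1},
-- the broadcaster sends the positions rev_L(j)·D + c (D = 2^{k−L}, j = 0, 1, …): one residue class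
-- modulo D whose quotients are scanned in bit-reversal order. The block Y_i sent the positions
-- (v·2^d + 2^d − 1)·D + h of a neighbouring class below it, where d = l_{i+1} − l_i.
-- The upper bound ub of the receiver only moves at a slot whose key exceeds κ'' and whose position
-- lies left of every such position seen since s. So the slots of Y_{i+1} where ub moves are records
-- of the scan: left-to-right minima among the positions whose key exceeds κ'', a set that is upward
-- closed since the keys are sorted. As t'' = s, already the key at s exceeds κ''; hence so does a
-- key of Y_i, and the first such v squeezes the candidate quotients of Y_{i+1} into the interval
-- [[v·2^d − 1, (v+1)·2^d − 2]], aligned of length 2^d but shifted one step down.
-- A bit-reversal scan of length 2^{L+1} is a scan of length 2^L of the even values followed by one
-- of the odd values. The odd half contributes at most one record, since each of its records sits
-- just above an even value outside the set, and the even half is the scan of the halved interval;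
-- induction on L bounds the number of records by max(d, 2).

module Submission where

open import Defs
open import Level using (Level)
open import Data.Nat using (ℕ; suc; _^_; _≤_; _<_; _∸_; _⊔_)
open import Data.Integer as ℤ using (+_; 1ℤ)
open import Relation.Binary.Bundles using (StrictTotalOrder)
open import Relation.Binary.PropositionalEquality using (_≢_)

open import Function using (_∘_)
open import Data.Bool using (if_then_else_)
open import Data.Nat
open import Data.Nat.Properties
open import Data.Nat.DivMod
open import Data.Nat.Divisibility using (_∣_; divides; _∣?_)
open import Data.Nat.ListAction using (sum)
open import Data.Nat.Tactic.RingSolver using (solve-∀)
open import Data.Integer using (ℤ)
import Data.Integer.Properties as ℤ
open import Data.List using (List; []; _∷_; length; map; concatMap; upTo; applyUpTo)
open import Data.List.Properties using (length-++; map-∘; map-upTo; length-deduplicate)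
open import Data.Product using (∃; _×_; _,_; proj₁; proj₂)
open import Data.Sum using (inj₁; inj₂)
open import Data.Empty using (⊥)
open import Relation.Nullary using (¬_; Dec; yes; no; contradiction)
open import Relation.Nullary.Decidable using (dec-true; dec-false)
open import Relation.Binary.PropositionalEquality

private variable ℓ : Level

2^suc≡2^+2^ : ∀ a → 2 ^ suc a ≡ 2 ^ a + 2 ^ a
2^suc≡2^+2^ a = cong (_+_ (2 ^ a)) (+-identityʳ (2 ^ a))

*+<* : ∀ {u N x D} → u < N → x < D → u * D + x < N * D
*+<* {u} {N} {x} {D} u<N x<D = begin-strict
  u * D + x <⟨ +-monoʳ-< (u * D) x<D ⟩
  u * D + D ≡⟨ +-comm (u * D) D ⟩
  suc u * D ≤⟨ *-monoˡ-≤ D u<N ⟩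
  N * D     ∎
  where open ≤-Reasoning

*+-cancel-< : ∀ D {a b x y} → y ≤ x → a * D + x < b * D + y → a < b
*+-cancel-< D {a} {b} y≤x lt = *-cancelʳ-< D a b (+-cancelʳ-< _ _ _ (<-≤-trans lt (+-monoʳ-≤ (b * D) y≤x)))

suc-pred-2^ : ∀ d → suc (pred (2 ^ d)) ≡ 2 ^ d
suc-pred-2^ d = suc-pred (2 ^ d) {{m^n≢0 2 d}}

*2^suc : ∀ c e → c * 2 ^ suc e ≡ c * 2 ^ e * 2
*2^suc c e = assoc c (2 ^ e)
  where
  assoc : ∀ c y → c * (2 * y) ≡ c * y * 2
  assoc = solve-∀

<⇒*2+1<*2 : ∀ {u w} → u < w → u * 2 + 1 < w * 2
<⇒*2+1<*2 {u} {w} u<w = subst (_< w * 2) (+-comm 1 (u * 2)) (*-monoˡ-≤ 2 u<w)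

*2≤1+*2⇒≤ : ∀ {c x} → c * 2 ≤ suc (x * 2) → c ≤ x
*2≤1+*2⇒≤ {c} {x} c*2≤ = ≮⇒≥ λ x<c →
  <-irrefl (+-comm (x * 2) 1) (<-≤-trans (<⇒*2+1<*2 x<c) c*2≤)

*2<2^suc : ∀ L {w} → w < 2 ^ L → w * 2 < 2 ^ suc L
*2<2^suc L {w} w<2^L = subst (w * 2 <_) (*-comm (2 ^ L) 2) (*-monoˡ-< 2 w<2^L)

-- Bit reversal

rev<2^ : ∀ a x → rev a x < 2 ^ a
rev<2^ zero    x = s≤s z≤n
rev<2^ (suc a) x = begin-strict
  x % 2 * 2 ^ a + rev a (x / 2) <⟨ +-mono-≤-< top-bit≤ (rev<2^ a (x / 2)) ⟩
  2 ^ a + 2 ^ a                 ≡⟨ 2^suc≡2^+2^ a ⟨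
  2 ^ suc a                     ∎
  where
  open ≤-Reasoning
  top-bit≤ : x % 2 * 2 ^ a ≤ 2 ^ a
  top-bit≤ = ≤-trans (*-monoˡ-≤ (2 ^ a) (m<1+n⇒m≤n (m%n<n x 2))) (≤-reflexive (*-identityˡ (2 ^ a)))

rev-suc-bit : ∀ a b T → b < 2 → rev (suc a) (b + T * 2) ≡ b * 2 ^ a + rev a T
rev-suc-bit a b T b<2 = cong₂ (λ p q → p * 2 ^ a + rev a q) low high
  where
  low : (b + T * 2) % 2 ≡ b
  low = trans ([m+kn]%n≡m%n b T 2) (m<n⇒m%n≡m b<2)
  high : (b + T * 2) / 2 ≡ T
  high = begin
    (b + T * 2) / 2   ≡⟨ +-distrib-/-∣ʳ b (divides T refl) ⟩
    b / 2 + T * 2 / 2 ≡⟨ cong₂ _+_ (m<n⇒m/n≡0 b<2) (m*n/n≡m T 2) ⟩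
    T                 ∎
    where open ≡-Reasoning

rev-+-* : ∀ a b j m → j < 2 ^ a → rev (a + b) (j + m * 2 ^ a) ≡ rev a j * 2 ^ b + rev b m
rev-+-* zero    b zero    m _         = cong (rev b) (*-identityʳ m)
rev-+-* zero    b (suc j) m (s≤s ())
rev-+-* (suc a) b j       m j<2^suc-a = begin
  rev (suc (a + b)) (j + m * 2 ^ suc a)
    ≡⟨ cong (rev (suc (a + b))) split-low-bit ⟩
  rev (suc (a + b)) (j % 2 + (j / 2 + m * 2 ^ a) * 2)
    ≡⟨ rev-suc-bit (a + b) (j % 2) _ (m%n<n j 2) ⟩
  j % 2 * 2 ^ (a + b) + rev (a + b) (j / 2 + m * 2 ^ a)
    ≡⟨ cong₂ (λ p q → j % 2 * p + q) (^-distribˡ-+-* 2 a b) (rev-+-* a b (j / 2) m j/2<2^a) ⟩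
  j % 2 * (2 ^ a * 2 ^ b) + (rev a (j / 2) * 2 ^ b + rev b m)
    ≡⟨ regroup (j % 2) (2 ^ a) (2 ^ b) (rev a (j / 2)) (rev b m) ⟩
  (j % 2 * 2 ^ a + rev a (j / 2)) * 2 ^ b + rev b m
    ∎
  where
  open ≡-Reasoning
  j/2<2^a : j / 2 < 2 ^ a
  j/2<2^a = m<n*o⇒m/o<n (subst (j <_) (*-comm 2 (2 ^ a)) j<2^suc-a)
  split-low-bit : j + m * 2 ^ suc a ≡ j % 2 + (j / 2 + m * 2 ^ a) * 2
  split-low-bit = trans (cong (_+ m * 2 ^ suc a) (m≡m%n+[m/n]*n j 2)) (shuffle (j % 2) (j / 2) m (2 ^ a))
    where
    shuffle : ∀ p q m y → p + q * 2 + m * (2 * y) ≡ p + (q + m * y) * 2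
    shuffle = solve-∀
  regroup : ∀ p y z r q → p * (y * z) + (r * z + q) ≡ (p * y + r) * z + q
  regroup = solve-∀

rev-suc-top : ∀ a j b → j < 2 ^ a → b < 2 → rev (suc a) (j + b * 2 ^ a) ≡ rev a j * 2 + b
rev-suc-top a j b j<2^a b<2 = begin
  rev (suc a) (j + b * 2 ^ a) ≡⟨ cong (λ c → rev c (j + b * 2 ^ a)) (+-comm 1 a) ⟩
  rev (a + 1) (j + b * 2 ^ a) ≡⟨ rev-+-* a 1 j b j<2^a ⟩
  rev a j * 2 + rev 1 b       ≡⟨ cong (_+_ (rev a j * 2)) rev-1 ⟩
  rev a j * 2 + b             ∎
  where
  open ≡-Reasoning
  rev-1 : rev 1 b ≡ b
  rev-1 = trans (+-identityʳ _) (trans (*-identityʳ _) (m<n⇒m%n≡m b<2))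

rev-suc-lower : ∀ a j → j < 2 ^ a → rev (suc a) j ≡ rev a j * 2
rev-suc-lower a j j<2^a =
  trans (cong (rev (suc a)) (sym (+-identityʳ j))) (trans (rev-suc-top a j 0 j<2^a (s≤s z≤n)) (+-identityʳ _))

rev-suc-upper : ∀ a j → j < 2 ^ a → rev (suc a) (2 ^ a + j) ≡ rev a j * 2 + 1
rev-suc-upper a j j<2^a =
  trans (cong (rev (suc a)) (trans (+-comm (2 ^ a) j) (cong (_+_ j) (sym (*-identityˡ (2 ^ a))))))
        (rev-suc-top a j 1 j<2^a (s≤s (s≤s z≤n)))

rev-involutive : ∀ a x → x < 2 ^ a → rev a (rev a x) ≡ x
rev-involutive zero    zero    _        = refl
rev-involutive zero    (suc x) (s≤s ())
rev-involutive (suc a) x       x<2^suc-a = begin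
  rev (suc a) (x % 2 * 2 ^ a + rev a (x / 2)) ≡⟨ cong (rev (suc a)) (+-comm (x % 2 * 2 ^ a) _) ⟩
  rev (suc a) (rev a (x / 2) + x % 2 * 2 ^ a) ≡⟨ rev-suc-top a _ (x % 2) (rev<2^ a (x / 2)) (m%n<n x 2) ⟩
  rev a (rev a (x / 2)) * 2 + x % 2            ≡⟨ cong (λ y → y * 2 + x % 2) (rev-involutive a (x / 2) x/2<2^a) ⟩
  x / 2 * 2 + x % 2                            ≡⟨ +-comm (x / 2 * 2) (x % 2) ⟩
  x % 2 + x / 2 * 2                            ≡⟨ m≡m%n+[m/n]*n x 2 ⟨
  x                                            ∎
  where
  open ≡-Reasoning
  x/2<2^a : x / 2 < 2 ^ a
  x/2<2^a = m<n*o⇒m/o<n (subst (x <_) (*-comm 2 (2 ^ a)) x<2^suc-a)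

rev-all-ones : ∀ d w → suc w ≡ 2 ^ d → rev d w ≡ w
rev-all-ones zero    zero    _             = refl
rev-all-ones (suc d) w       suc-w≡2^suc-d = begin
  rev (suc d) w            ≡⟨ cong (rev (suc d)) w≡ ⟩
  rev (suc d) (1 + w₀ * 2) ≡⟨ rev-suc-bit d 1 w₀ (s≤s (s≤s z≤n)) ⟩
  1 * 2 ^ d + rev d w₀     ≡⟨ cong₂ (λ p q → 1 * p + q) (sym 2^d≡) (rev-all-ones d w₀ 2^d≡) ⟩
  1 * suc w₀ + w₀          ≡⟨ odd w₀ ⟩
  1 + w₀ * 2               ≡⟨ w≡ ⟨
  w                        ∎
  where
  open ≡-Reasoning
  w₀ : ℕ
  w₀ = pred (2 ^ d)
  2^d≡ : suc w₀ ≡ 2 ^ d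
  2^d≡ = suc-pred-2^ d
  double : ∀ w₀ → suc w₀ + (suc w₀ + 0) ≡ suc (1 + w₀ * 2)
  double = solve-∀
  w≡ : w ≡ 1 + w₀ * 2
  w≡ = suc-injective (trans suc-w≡2^suc-d (trans (cong (λ y → y + (y + 0)) (sym 2^d≡)) (double w₀)))
  odd : ∀ w₀ → 1 * suc w₀ + w₀ ≡ 1 + w₀ * 2
  odd = solve-∀

sum-applyUpTo-+ : ∀ (f : ℕ → ℕ) m n →
  sum (applyUpTo f (m + n)) ≡ sum (applyUpTo f m) + sum (applyUpTo (λ j → f (m + j)) n)
sum-applyUpTo-+ f zero    n = refl
sum-applyUpTo-+ f (suc m) n =
  trans (cong (_+_ (f 0)) (sum-applyUpTo-+ (f ∘ suc) m n)) (sym (+-assoc (f 0) _ _))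

sum-applyUpTo≡0 : ∀ (f : ℕ → ℕ) n → (∀ j → j < n → f j ≡ 0) → sum (applyUpTo f n) ≡ 0
sum-applyUpTo≡0 f zero    _   = refl
sum-applyUpTo≡0 f (suc n) f≡0 =
  cong₂ _+_ (f≡0 0 z<s) (sum-applyUpTo≡0 (f ∘ suc) n (λ j j<n → f≡0 (suc j) (s≤s j<n)))

sum-applyUpTo≤1 : ∀ (f : ℕ → ℕ) n → (∀ j → f j ≤ 1) →
  (∀ j₁ j₂ → j₁ < j₂ → j₂ < n → 0 < f j₁ → 0 < f j₂ → ⊥) → sum (applyUpTo f n) ≤ 1
sum-applyUpTo≤1 f zero    _   _      = z≤n
sum-applyUpTo≤1 f (suc n) f≤1 unique with f 0 in f0≡
... | zero  = sum-applyUpTo≤1 (f ∘ suc) n (f≤1 ∘ suc)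
                (λ j₁ j₂ j₁<j₂ j₂<n → unique (suc j₁) (suc j₂) (s≤s j₁<j₂) (s≤s j₂<n))
... | suc m = begin
  suc m + sum (applyUpTo (f ∘ suc) n) ≡⟨ cong₂ _+_ (sym f0≡) rest≡0 ⟩
  f 0 + 0                             ≡⟨ +-identityʳ (f 0) ⟩
  f 0                                 ≤⟨ f≤1 0 ⟩
  1                                   ∎
  where
  open ≤-Reasoning
  rest≡0 : sum (applyUpTo (f ∘ suc) n) ≡ 0
  rest≡0 = sum-applyUpTo≡0 (f ∘ suc) n λ j j<n →
    n≤0⇒n≡0 (≮⇒≥ (unique 0 (suc j) z<s (s≤s j<n) (subst (0 <_) (sym f0≡) z<s)))

-- Records of a bit-reversal scan

IsRecord : ℕ → (ℕ → Set ℓ) → ℕ → ℕ → Set ℓ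
IsRecord L Q b j = Q (rev L j) × rev L j < b × (∀ j' → j' < j → Q (rev L j') → rev L j < rev L j')

UpwardClosed : ℕ → (ℕ → Set ℓ) → Set ℓ
UpwardClosed L Q = ∀ x y → x ≤ y → y < 2 ^ L → Q x → Q y

UpwardClosed-even : ∀ L (Q : ℕ → Set ℓ) → UpwardClosed (suc L) Q → UpwardClosed L (Q ∘ (_* 2))
UpwardClosed-even L Q up x y x≤y y<2^L = up (x * 2) (y * 2) (*-monoˡ-≤ 2 x≤y) (*2<2^suc L y<2^L)

-- Records are counted through any 0/1-valued f vanishing off them, as IsRecord is not decidable.
module Records (f : ℕ → ℕ) (f≤1 : ∀ j → f j ≤ 1) where

  count : ℕ → ℕ
  count L = sum (applyUpTo f (2 ^ L))

  upper-count : ℕ → ℕ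
  upper-count L = sum (applyUpTo (λ j → f (2 ^ L + j)) (2 ^ L))

  count-suc : ∀ L → count (suc L) ≡ count L + upper-count L
  count-suc L = trans (cong (sum ∘ applyUpTo f) (2^suc≡2^+2^ L)) (sum-applyUpTo-+ f (2 ^ L) (2 ^ L))

  count-zero≤1 : count 0 ≤ 1
  count-zero≤1 = ≤-trans (≤-reflexive (+-identityʳ (f 0))) (f≤1 0)

  record RecordsOnly (L : ℕ) (Q : ℕ → Set ℓ) (b : ℕ) : Set ℓ where
    constructor records-only
    field is-record : ∀ j → j < 2 ^ L → 0 < f j → IsRecord L Q b j

  module _ {L : ℕ} {Q : ℕ → Set ℓ} {b : ℕ} where

    count≡0 : RecordsOnly L Q b → (∀ x → Q x → b ≤ x) → count L ≡ 0
    count≡0 (records-only records) b≤Q = sum-applyUpTo≡0 f (2 ^ L) λ j j<2^L → n≤0⇒n≡0 (≮⇒≥ λ 0<fj →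
      let (q , <b , _) = records j j<2^L 0<fj in <⇒≱ <b (b≤Q _ q))

    count≤1 : RecordsOnly L Q b → (∀ x y → Q x → x < b → Q y → y < b → x ≡ y) → count L ≤ 1
    count≤1 (records-only records) single = sum-applyUpTo≤1 f (2 ^ L) f≤1 λ j₁ j₂ j₁<j₂ j₂<2^L 0<fj₁ 0<fj₂ →
      let (q₁ , <b₁ , _)       = records j₁ (<-trans j₁<j₂ j₂<2^L) 0<fj₁
          (q₂ , <b₂ , earlier) = records j₂ j₂<2^L 0<fj₂
      in <-irrefl (single _ _ q₂ <b₂ q₁ <b₁) (earlier j₁ j₁<j₂ q₁)

  module _ {L : ℕ} {Q : ℕ → Set ℓ} {b : ℕ} (records : RecordsOnly (suc L) Q b) where
    open RecordsOnly records

    RecordsOnly-even : ∀ b' → b ≤ b' * 2 → RecordsOnly L (Q ∘ (_* 2)) b'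
    RecordsOnly-even b' b≤b'*2 = records-only even-record
      where
      lower : ∀ j → j < 2 ^ L → rev (suc L) j ≡ rev L j * 2
      lower = rev-suc-lower L
      even-record : ∀ j → j < 2 ^ L → 0 < f j → IsRecord L (Q ∘ (_* 2)) b' j
      even-record j j<2^L 0<fj with is-record j (<-≤-trans j<2^L (m≤m+n (2 ^ L) _)) 0<fj
      ... | q , <b , earlier =
          subst Q (lower j j<2^L) q
        , *-cancelʳ-< 2 _ _ (<-≤-trans (subst (_< b) (lower j j<2^L) <b) b≤b'*2)
        , λ j' j'<j q' → *-cancelʳ-< 2 _ _ (subst₂ _<_ (lower j j<2^L) (lower j' (<-trans j'<j j<2^L))
                           (earlier j' j'<j (subst Q (sym (lower j' (<-trans j'<j j<2^L))) q')))

    upper-record : ∀ j → j < 2 ^ L → 0 < f (2 ^ L + j) →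
      Q (rev L j * 2 + 1) × ¬ Q (rev L j * 2) × (∀ j' → j' < j → Q (rev L j' * 2 + 1) → rev L j < rev L j')
    upper-record j j<2^L 0<fj with is-record (2 ^ L + j) index< 0<fj
      where
      index< : 2 ^ L + j < 2 ^ suc L
      index< = subst (2 ^ L + j <_) (sym (2^suc≡2^+2^ L)) (+-monoʳ-< (2 ^ L) j<2^L)
    ... | q , _ , earlier =
        subst Q (upper j j<2^L) q
      , (λ q-even → <-irrefl refl (<-trans
           (subst₂ _<_ (upper j j<2^L) (lower j j<2^L)
              (earlier j (m<n+m j (m^n>0 2 L)) (subst Q (sym (lower j j<2^L)) q-even)))
           (m<m+n _ z<s)))
      , λ j' j'<j q' → let upper' = upper j' (<-trans j'<j j<2^L) in
          *-cancelʳ-< 2 _ _ (+-cancelʳ-< 1 _ _ (subst₂ _<_ (upper j j<2^L) upper'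
            (earlier (2 ^ L + j') (+-monoʳ-< (2 ^ L) j'<j) (subst Q (sym upper') q'))))
      where
      lower : ∀ j → j < 2 ^ L → rev (suc L) j ≡ rev L j * 2
      lower = rev-suc-lower L
      upper : ∀ j → j < 2 ^ L → rev (suc L) (2 ^ L + j) ≡ rev L j * 2 + 1
      upper = rev-suc-upper L

    upper-count≤1 : UpwardClosed (suc L) Q → upper-count L ≤ 1
    upper-count≤1 up = sum-applyUpTo≤1 _ (2 ^ L) (f≤1 ∘ (_+_ (2 ^ L)))
      λ j₁ j₂ j₁<j₂ j₂<2^L 0<fj₁ 0<fj₂ →
        let (q₁ , ¬q₁ , _)       = upper-record j₁ (<-trans j₁<j₂ j₂<2^L) 0<fj₁
            (q₂ , _ , earlier₂) = upper-record j₂ j₂<2^L 0<fj₂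
        in ¬q₁ (up _ _ (<⇒≤ (<⇒*2+1<*2 (earlier₂ j₁ j₁<j₂ q₁))) (*2<2^suc L (rev<2^ L j₁)) q₂)

    upper-count≡0 : UpwardClosed (suc L) Q → ∀ a → Q (a * 2) → (∀ x → Q x → a * 2 ≤ x) → upper-count L ≡ 0
    upper-count≡0 up a q-a a*2≤Q = sum-applyUpTo≡0 _ (2 ^ L) λ j j<2^L → n≤0⇒n≡0 (≮⇒≥ λ 0<fj →
      let (q , ¬q-even , _) = upper-record j j<2^L 0<fj
          w<a : rev L j < a
          w<a = *-cancelʳ-< 2 _ _ (≰⇒> λ a*2≤w*2 →
                  ¬q-even (up _ _ a*2≤w*2 (*2<2^suc L (rev<2^ L j)) q-a))
      in <⇒≱ (<⇒*2+1<*2 w<a) (a*2≤Q _ q))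

  -- The even half of a scan of length 2^(L+1) is the scan of length 2^L for Q ∘ (_* 2), in which the
  -- interval [c·2^(e+1), (c+1)·2^(e+1)) becomes [c·2^e, (c+1)·2^e); the odd half adds at most one
  -- record, and none once c·2^(e+1) ∈ Q.
  count≤1-if-Q-contains-block-start : ∀ L e c (Q : ℕ → Set ℓ) b → UpwardClosed L Q → RecordsOnly L Q b →
    Q (c * 2 ^ e) → (∀ x → Q x → c * 2 ^ e ≤ x) → b ≤ suc c * 2 ^ e → count L ≤ 1
  count≤1-if-Q-contains-block-start L zero c Q b _ records _ start≤Q b≤ =
    count≤1 records λ x y qx x<b qy y<b → trans (is-start x qx x<b) (sym (is-start y qy y<b))
    where
    is-start : ∀ x → Q x → x < b → x ≡ c * 1
    is-start x qx x<b = ≤-antisym (m<1+n⇒m≤n (<-≤-trans x<b b≤)) (start≤Q x qx)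
  count≤1-if-Q-contains-block-start zero (suc e) c Q b _ _ _ _ _ = count-zero≤1
  count≤1-if-Q-contains-block-start (suc L) (suc e) c Q b up records q-start start≤Q b≤ = begin
    count (suc L)           ≡⟨ count-suc L ⟩
    count L + upper-count L ≤⟨ +-mono-≤ lower (≤-reflexive upper) ⟩
    1                       ∎
    where
    open ≤-Reasoning
    start-even : Q (c * 2 ^ e * 2)
    start-even = subst Q (*2^suc c e) q-start
    start≤Q-even : ∀ x → Q x → c * 2 ^ e * 2 ≤ x
    start≤Q-even x qx = subst (_≤ x) (*2^suc c e) (start≤Q x qx)
    lower : count L ≤ 1
    lower = count≤1-if-Q-contains-block-start L e c (Q ∘ (_* 2)) (suc c * 2 ^ e) (UpwardClosed-even L Q up)
      (RecordsOnly-even records _ (subst (b ≤_) (*2^suc (suc c) e) b≤))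
      start-even (λ x qx → *-cancelʳ-≤ _ _ 2 (start≤Q-even (x * 2) qx)) ≤-refl
    upper : upper-count L ≡ 0
    upper = upper-count≡0 records up (c * 2 ^ e) start-even start≤Q-even

  count≤e-if-Q-misses-block-start : ∀ L e c (Q : ℕ → Set ℓ) b → UpwardClosed L Q → RecordsOnly L Q b →
    (∀ x → Q x → c * 2 ^ e < x) → b ≤ suc c * 2 ^ e → count L ≤ e
  count≤e-if-Q-misses-block-start L zero c Q b _ records start<Q b≤ =
    ≤-reflexive (count≡0 records λ x qx → ≤-trans b≤ (start<Q x qx))
  count≤e-if-Q-misses-block-start zero (suc e) c Q b _ _ _ _ = ≤-trans count-zero≤1 (s≤s z≤n)
  count≤e-if-Q-misses-block-start (suc L) (suc e) c Q b up records start<Q b≤ = begin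
    count (suc L)           ≡⟨ count-suc L ⟩
    count L + upper-count L ≤⟨ +-mono-≤ lower (upper-count≤1 records up) ⟩
    e + 1                   ≡⟨ +-comm e 1 ⟩
    suc e                   ∎
    where
    open ≤-Reasoning
    lower : count L ≤ e
    lower = count≤e-if-Q-misses-block-start L e c (Q ∘ (_* 2)) (suc c * 2 ^ e) (UpwardClosed-even L Q up)
      (RecordsOnly-even records _ (subst (b ≤_) (*2^suc (suc c) e) b≤))
      (λ x qx → *-cancelʳ-< 2 _ _ (subst (_< x * 2) (*2^suc c e) (start<Q (x * 2) qx))) ≤-refl

  count≤e⊔1-within-block : ∀ L e c (Q : ℕ → Set ℓ) b → UpwardClosed L Q → RecordsOnly L Q b →
    Dec (Q (c * 2 ^ e)) → (∀ x → Q x → c * 2 ^ e ≤ x) → b ≤ suc c * 2 ^ e → count L ≤ e ⊔ 1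
  count≤e⊔1-within-block L e c Q b up records (yes q-start) start≤Q b≤ =
    ≤-trans (count≤1-if-Q-contains-block-start L e c Q b up records q-start start≤Q b≤) (m≤n⊔m e 1)
  count≤e⊔1-within-block L e c Q b up records (no ¬q-start) start≤Q b≤ =
    ≤-trans (count≤e-if-Q-misses-block-start L e c Q b up records start<Q b≤) (m≤m⊔n e 1)
    where
    start<Q : ∀ x → Q x → c * 2 ^ e < x
    start<Q x qx = ≤∧≢⇒< (start≤Q x qx) λ start≡x → ¬q-start (subst Q (sym start≡x) qx)

  count≤d⊔2-within-shifted-block : ∀ L d c (Q : ℕ → Set ℓ) b → UpwardClosed L Q → RecordsOnly L Q b →
    (∀ x → Dec (Q x)) → (∀ x → Q x → c * 2 ^ d ≤ suc x) → suc b ≤ suc c * 2 ^ d → count L ≤ d ⊔ 2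
  count≤d⊔2-within-shifted-block zero d c Q b _ _ _ _ _ = ≤-trans count-zero≤1 (≤-trans (s≤s z≤n) (m≤n⊔m d 2))
  count≤d⊔2-within-shifted-block (suc L) zero c Q b _ records _ start≤1+Q b< =
    ≤-trans (count≤1 records λ x y qx x<b qy y<b →
               suc-injective (trans (is-pred-start x qx x<b) (sym (is-pred-start y qy y<b))))
            (s≤s z≤n)
    where
    is-pred-start : ∀ x → Q x → x < b → suc x ≡ c * 1
    is-pred-start x qx x<b = ≤-antisym (<-≤-trans x<b (m<1+n⇒m≤n b<)) (start≤1+Q x qx)
  count≤d⊔2-within-shifted-block (suc L) (suc d) c Q b up records Q? start≤1+Q b< = begin
    count (suc L)           ≡⟨ count-suc L ⟩
    count L + upper-count L ≤⟨ +-mono-≤ lower (upper-count≤1 records up) ⟩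
    d ⊔ 1 + 1               ≡⟨ +-comm (d ⊔ 1) 1 ⟩
    suc d ⊔ 2               ∎
    where
    open ≤-Reasoning
    lower : count L ≤ d ⊔ 1
    lower = count≤e⊔1-within-block L d c (Q ∘ (_* 2)) (suc c * 2 ^ d) (UpwardClosed-even L Q up)
      (RecordsOnly-even records _ (<⇒≤ (subst (b <_) (*2^suc (suc c) d) b<)))
      (Q? _) (λ x qx → *2≤1+*2⇒≤ (subst (_≤ suc (x * 2)) (*2^suc c d) (start≤1+Q (x * 2) qx))) ≤-refl

-- The schedule t_i, l_i

lmax≤ : ∀ l t → lmax l t ≤ l
lmax≤ zero    t = z≤n
lmax≤ (suc l) t with 2 ^ suc l ∣? t
... | yes _ = ≤-refl
... | no  _ = m≤n⇒m≤1+n (lmax≤ l t)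

2^lmax∣ : ∀ l t → 2 ^ lmax l t ∣ t
2^lmax∣ zero    t = divides t (sym (*-identityʳ t))
2^lmax∣ (suc l) t with 2 ^ suc l ∣? t
... | yes 2^suc-l∣t = 2^suc-l∣t
... | no  _         = 2^lmax∣ l t

lmax-maximal : ∀ l t m → m ≤ l → 2 ^ m ∣ t → m ≤ lmax l t
lmax-maximal zero    t m m≤0     _     = m≤0
lmax-maximal (suc l) t m m≤suc-l 2^m∣t with 2 ^ suc l ∣? t | m≤n⇒m<n∨m≡n m≤suc-l
... | yes _          | _           = m≤suc-l
... | no  _          | inj₁ m<suc-l = lmax-maximal l t m (m<1+n⇒m≤n m<suc-l) 2^m∣t
... | no  2^suc-l∤t  | inj₂ refl    = contradiction 2^m∣t 2^suc-l∤t

lmax-odd-part : ∀ k t → lmax k t < k → ∃ λ T → t ≡ (1 + T * 2) * 2 ^ lmax k t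
lmax-odd-part k t l<k with 2^lmax∣ k t
... | divides q t≡q*2^l with q % 2 | m%n<n q 2 | m≡m%n+[m/n]*n q 2
...   | 0 | _ | q≡ = contradiction (lmax-maximal k t (suc l) l<k (divides (q / 2) t≡)) 1+n≰n
  where
  l = lmax k t
  t≡ : t ≡ q / 2 * 2 ^ suc l
  t≡ = trans t≡q*2^l (trans (cong (_* 2 ^ l) q≡) (regroup (q / 2) (2 ^ l)))
    where
    regroup : ∀ x y → (0 + x * 2) * y ≡ x * (2 * y)
    regroup = solve-∀
...   | 1 | _ | q≡ = q / 2 , trans t≡q*2^l (cong (_* 2 ^ lmax k t) q≡)
...   | suc (suc _) | s≤s (s≤s ()) | _

length-concatMap : ∀ {a b} {A : Set a} {B : Set b} (g : A → List B) xs →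
  length (concatMap g xs) ≡ sum (map (length ∘ g) xs)
length-concatMap g []       = refl
length-concatMap g (x ∷ xs) = trans (length-++ (g x)) (cong (_+_ (length (g x))) (length-concatMap g xs))

length-concatMap-upTo : ∀ {b} {B : Set b} (g : ℕ → List B) (h : ℕ → ℕ) N →
  length (concatMap g (map h (upTo N))) ≡ sum (applyUpTo (length ∘ g ∘ h) N)
length-concatMap-upTo g h N = trans (length-concatMap g (map h (upTo N)))
  (cong sum (trans (sym (map-∘ (upTo N))) (map-upTo (length ∘ g ∘ h) N)))

run-start : ∀ {P : ℕ → Set ℓ} → (∀ n → Dec (P n)) → ∀ n → P n →
  ∃ λ m → m ≤ n × P m × (∀ m' → m ≡ suc m' → ¬ P m')
run-start P? zero    p = 0 , z≤n , p , λ _ ()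
run-start P? (suc n) p with P? n
... | yes pn = let (m , m≤n , pm , edge) = run-start P? n pn in m , m≤n⇒m≤1+n m≤n , pm , edge
... | no ¬pn = suc n , ≤-refl , p , λ { _ refl → ¬pn }

module _ {a ℓ₁ ℓ₂ : Level} (O : StrictTotalOrder a ℓ₁ ℓ₂)
         (k : ℕ) (κ : ℕ → StrictTotalOrder.Carrier O)
         (κ' κ'' : StrictTotalOrder.Carrier O) (s : ℕ) where
  open RBO O k κ κ' κ'' s
  open StrictTotalOrder O using (module Eq; irrefl; <-respʳ-≈; <-respˡ-≈)
    renaming (_<_ to _≺_; _<?_ to _≺?_; trans to ≺-trans)
  import Relation.Binary.Construct.StrictToNonStrict (StrictTotalOrder._≈_ O) _≺_ as NonStrict

  ls<ls-suc : ∀ j → ls j < k → ls j < ls (suc j)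
  ls<ls-suc j l<k with lmax-odd-part k (ts j) l<k
  ... | T , tj≡ = lmax-maximal k (ts (suc j)) (suc (ls j)) l<k (divides (suc T) t-suc≡)
    where
    regroup : ∀ T y → (1 + T * 2) * y + y ≡ suc T * (2 * y)
    regroup = solve-∀
    t-suc≡ : ts j + 2 ^ ls j ≡ suc T * 2 ^ suc (ls j)
    t-suc≡ = trans (cong (_+ 2 ^ ls j) tj≡) (regroup T (2 ^ ls j))

  ts-window : ∀ j → (∀ j' → j' < j → ls j' < k) → s ≤ ts j × ts j < s + 2 ^ ls j
  ts-window zero    _    = ≤-refl , m<m+n s (m^n>0 2 (ls 0))
  ts-window (suc j) ls<k with ts-window j (λ j' j'<j → ls<k j' (m<n⇒m<1+n j'<j))
  ... | s≤tj , tj< = ≤-trans s≤tj (m≤m+n (ts j) _) , (begin-strict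
    ts j + 2 ^ ls j           <⟨ +-monoˡ-< (2 ^ ls j) tj< ⟩
    s + 2 ^ ls j + 2 ^ ls j   ≡⟨ +-assoc s _ _ ⟩
    s + (2 ^ ls j + 2 ^ ls j) ≡⟨ cong (_+_ s) (2^suc≡2^+2^ (ls j)) ⟨
    s + 2 ^ suc (ls j)        ≤⟨ +-monoʳ-≤ s (^-monoʳ-≤ 2 (ls<ls-suc j (ls<k j ≤-refl))) ⟩
    s + 2 ^ ls (suc j)        ∎)
    where open ≤-Reasoning

  -- The receiver

  module Receiver (mono : ∀ i j → i ≤ j → j < 2 ^ k → LeO O (κ i) (κ j)) (κ'≤κ'' : LeO O κ' κ'') where

    ≺-≼-trans : ∀ {x y z} → x ≺ y → LeO O y z → x ≺ z
    ≺-≼-trans = NonStrict.<-≤-trans ≺-trans <-respʳ-≈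

    ≼-≺-trans : ∀ {x y z} → LeO O x y → y ≺ z → x ≺ z
    ≼-≺-trans = NonStrict.≤-<-trans Eq.sym ≺-trans <-respˡ-≈

    Above : ℕ → Set ℓ₂
    Above x = κ'' ≺ κ x

    Above? : ∀ x → Dec (Above x)
    Above? x = κ'' ≺? κ x

    Above-upward : UpwardClosed k Above
    Above-upward x y x≤y y<n above = ≺-≼-trans above (mono x y x≤y y<n)

    ¬below∧above : ∀ {x} → κ x ≺ κ' → ¬ Above x
    ¬below∧above below above = irrefl Eq.refl (≺-≼-trans (≺-trans above below) κ'≤κ'')

    InWindow : ℤ → ℤ → ℕ → Set
    InWindow lb ub r = lb ℤ.≤ + r × + r ℤ.≤ ub

    data StepView (t : ℕ) (lb ub : ℤ) : State → Set ℓ₂ where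
      outside : ¬ InWindow lb ub (rev k t) → StepView t lb ub (lb , ub)
      raise   : κ (rev k t) ≺ κ' → StepView t lb ub (+ rev k t ℤ.+ 1ℤ , ub)
      lower   : InWindow lb ub (rev k t) → Above (rev k t) → StepView t lb ub (lb , + rev k t ℤ.- 1ℤ)
      keep    : ¬ Above (rev k t) → StepView t lb ub (lb , ub)

    step-view : ∀ t lb ub → StepView t lb ub (step t (lb , ub))
    step-view t lb ub with lb ℤ.≤? + rev k t | + rev k t ℤ.≤? ub
    ... | no  lb≰r | _        = outside λ (lb≤r , _) → lb≰r lb≤r
    ... | yes _    | no  r≰ub = outside λ (_ , r≤ub) → r≰ub r≤ub
    ... | yes lb≤r | yes r≤ub with κ (rev k t) ≺? κ' | Above? (rev k t)
    ...   | yes below | _           = raise below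
    ...   | no  _     | yes above   = lower (lb≤r , r≤ub) above
    ...   | no  _     | no  ¬above  = keep ¬above

    lb : ℕ → ℤ
    lb t = proj₁ (state t)

    state≡init : ∀ t → t ≤ s → state t ≡ init
    state≡init zero    _   = refl
    state≡init (suc t) t<s = cong (λ b → if b then init else step t (state t)) (dec-true (t <? s) t<s)

    state-suc≡step : ∀ t → s ≤ t → state (suc t) ≡ step t (state t)
    state-suc≡step t s≤t = cong (λ b → if b then init else step t (state t)) (dec-false (t <? s) (≤⇒≯ s≤t))

    -- The invariant of lb; it keeps a key above κ'' inside [[lb, ub]] from being skipped.
    KeysBelowQuery : ℤ → Set ℓ₂
    KeysBelowQuery lb = ∀ x → + x ℤ.< lb → κ x ≺ κ'

    step-keeps-KeysBelowQuery : ∀ {t lb ub σ} → StepView t lb ub σ →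
                                KeysBelowQuery lb → KeysBelowQuery (proj₁ σ)
    step-keeps-KeysBelowQuery (outside _) sound = sound
    step-keeps-KeysBelowQuery {t} (raise below) _ x x<r+1 =
      ≼-≺-trans (mono x (rev k t) (m<1+n⇒m≤n (subst (x <_) (+-comm (rev k t) 1) (ℤ.drop‿+<+ x<r+1)))
                                  (rev<2^ k t)) below
    step-keeps-KeysBelowQuery (lower _ _) sound = sound
    step-keeps-KeysBelowQuery (keep _) sound = sound

    lb-sound : ∀ t → KeysBelowQuery (lb t)
    lb-sound zero    x (ℤ.+<+ ())
    lb-sound (suc t) with t <? s
    ... | yes t<s = subst (KeysBelowQuery ∘ proj₁) (sym (state≡init (suc t) t<s)) λ { x (ℤ.+<+ ()) }
    ... | no  t≮s = subst (KeysBelowQuery ∘ proj₁) (sym (state-suc≡step t (≮⇒≥ t≮s)))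
                      (step-keeps-KeysBelowQuery (step-view t (lb t) (ub t)) (lb-sound t))

    step-ub≤ : ∀ {t lb ub σ} → StepView t lb ub σ → proj₂ σ ℤ.≤ ub
    step-ub≤ (outside _)          = ℤ.≤-refl
    step-ub≤ (raise _)            = ℤ.≤-refl
    step-ub≤ (lower (_ , r≤ub) _) = ℤ.≤-trans (ℤ.i≤j⇒i-k≤j 1ℤ ℤ.≤-refl) r≤ub
    step-ub≤ (keep _)             = ℤ.≤-refl

    step-ub-changed : ∀ {t lb ub σ} → StepView t lb ub σ → proj₂ σ ≢ ub → Above (rev k t) × + rev k t ℤ.≤ ub
    step-ub-changed (outside _)             changed = contradiction refl changed
    step-ub-changed (raise _)               changed = contradiction refl changed
    step-ub-changed (lower (_ , r≤ub) above) _      = above , r≤ub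
    step-ub-changed (keep _)                changed = contradiction refl changed

    step-ub<Above : ∀ {t lb ub σ} → KeysBelowQuery lb → StepView t lb ub σ →
                    Above (rev k t) → proj₂ σ ℤ.< + rev k t
    step-ub<Above {t} sound (outside ¬window) above = ℤ.≰⇒> λ r≤ub → ¬window (lb≤r , r≤ub)
      where
      lb≤r : _ ℤ.≤ + rev k t
      lb≤r = ℤ.≮⇒≥ λ r<lb → ¬below∧above (sound (rev k t) r<lb) above
    step-ub<Above sound (raise below) above = contradiction above (¬below∧above below)
    step-ub<Above sound (lower _ _)   _     = ℤ.i≤pred[j]⇒i<j ℤ.≤-refl
    step-ub<Above sound (keep ¬above) above = contradiction above ¬above

    ub-suc≡ub : ∀ t → t < s → ub (suc t) ≡ ub t
    ub-suc≡ub t t<s = cong proj₂ (trans (state≡init (suc t) t<s) (sym (state≡init t (<⇒≤ t<s))))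

    ub-suc≤ : ∀ t → ub (suc t) ℤ.≤ ub t
    ub-suc≤ t with t <? s
    ... | yes t<s = ℤ.≤-reflexive (ub-suc≡ub t t<s)
    ... | no  t≮s = subst (λ σ → proj₂ σ ℤ.≤ ub t) (sym (state-suc≡step t (≮⇒≥ t≮s)))
                      (step-ub≤ (step-view t (lb t) (ub t)))

    ub-antitone : ∀ t t' → t ≤ t' → ub t' ℤ.≤ ub t
    ub-antitone t zero    z≤n = ℤ.≤-refl
    ub-antitone t (suc t') t≤suc-t' with m≤n⇒m<n∨m≡n t≤suc-t'
    ... | inj₁ t<suc-t' = ℤ.≤-trans (ub-suc≤ t') (ub-antitone t t' (m<1+n⇒m≤n t<suc-t'))
    ... | inj₂ refl     = ℤ.≤-refl

    ub-changed : ∀ t → ub (suc t) ≢ ub t → Above (rev k t) × + rev k t ℤ.≤ ub t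
    ub-changed t with t <? s
    ... | yes t<s = λ changed → contradiction (ub-suc≡ub t t<s) changed
    ... | no  t≮s = subst (λ σ → proj₂ σ ≢ ub t → Above (rev k t) × + rev k t ℤ.≤ ub t)
                      (sym (state-suc≡step t (≮⇒≥ t≮s))) (step-ub-changed (step-view t (lb t) (ub t)))

    ub<Above : ∀ t → s ≤ t → Above (rev k t) → ub (suc t) ℤ.< + rev k t
    ub<Above t s≤t = subst (λ σ → Above (rev k t) → proj₂ σ ℤ.< + rev k t) (sym (state-suc≡step t s≤t))
                       (step-ub<Above (lb-sound t) (step-view t (lb t) (ub t)))

    change-below-earlier-Above : ∀ t' t → s ≤ t' → t' < t → Above (rev k t') →
                                 ub (suc t) ≢ ub t → rev k t < rev k t'
    change-below-earlier-Above t' t s≤t' t'<t above changed = ℤ.drop‿+<+ (ℤ.≤-<-trans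
      (proj₂ (ub-changed t changed)) (ℤ.≤-<-trans (ub-antitone (suc t') t t'<t) (ub<Above t' s≤t' above)))

    length-U≤1 : ∀ t → length (U t) ≤ 1
    length-U≤1 t with ub (suc t) ℤ.≟ ub t
    ... | yes _ = z≤n
    ... | no  _ = ≤-refl

    U-nonempty⇒ub-changed : ∀ t → 0 < length (U t) → ub (suc t) ≢ ub t
    U-nonempty⇒ub-changed t with ub (suc t) ℤ.≟ ub t
    ... | yes _       = λ ()
    ... | no  changed = λ _ → changed

    first-slot-Above : ub (suc s) ℤ.+ 1ℤ ℤ.≤ + n ℤ.- 1ℤ → Above (rev k s)
    first-slot-Above ub+1≤ = proj₁ (ub-changed s λ unchanged →
      ℤ.<-irrefl refl (ℤ.suc[i]≤j⇒i<j (subst (ℤ._≤ ub s) (ℤ.+-comm (ub s) 1ℤ)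
        (subst₂ ℤ._≤_ (cong (ℤ._+ 1ℤ) unchanged) (cong proj₂ (sym (state≡init s ≤-refl))) ub+1≤))))

    -- As t_{i+1} = (2T+1)·2^L, the top k − L bits of a slot are constant on Y_{i+1} and on
    -- [[2T·2^L, t_{i+1} − 1]], which contains Y_i and s; bit reversal turns them into the residue
    -- of a position modulo D.
    module Block (i : ℕ) (ls<k : ∀ j → j ≤ suc i → ls j < k) (s-Above : Above (rev k s)) where

      l L K d : ℕ
      l = ls i
      L = ls (suc i)
      K = k ∸ suc L
      d = L ∸ l

      l<L : l < L
      l<L = ls<ls-suc i (ls<k i (n≤1+n i))

      k≡ : k ≡ L + suc K
      k≡ = trans (sym (m+[n∸m]≡n (ls<k (suc i) ≤-refl))) (sym (+-suc L K))

      D W w : ℕ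
      D = 2 ^ suc K
      W = 2 ^ d
      w = pred W

      suc-w≡W : suc w ≡ W
      suc-w≡W = suc-pred-2^ d

      2^L≡2^l*W : 2 ^ L ≡ 2 ^ l * W
      2^L≡2^l*W = trans (cong (2 ^_) (sym (m+[n∸m]≡n (<⇒≤ l<L)))) (^-distribˡ-+-* 2 l d)

      2^L≡2^l+w*2^l : 2 ^ L ≡ 2 ^ l + w * 2 ^ l
      2^L≡2^l+w*2^l = trans 2^L≡2^l*W (trans (*-comm (2 ^ l) W) (cong (_* 2 ^ l) (sym suc-w≡W)))

      T : ℕ
      T = proj₁ (lmax-odd-part k (ts (suc i)) (ls<k (suc i) ≤-refl))

      ts-suc≡ : ts (suc i) ≡ (1 + T * 2) * 2 ^ L
      ts-suc≡ = proj₂ (lmax-odd-part k (ts (suc i)) (ls<k (suc i) ≤-refl))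

      base h c : ℕ
      base = T * 2 * 2 ^ L
      h = rev K T
      c = 2 ^ K + h

      rev-k-block : ∀ x b → x < 2 ^ L → b < 2 →
                    rev k (x + (b + T * 2) * 2 ^ L) ≡ rev L x * D + (b * 2 ^ K + h)
      rev-k-block x b x<2^L b<2 = begin
        rev k (x + (b + T * 2) * 2 ^ L)             ≡⟨ cong (λ m → rev m (x + (b + T * 2) * 2 ^ L)) k≡ ⟩
        rev (L + suc K) (x + (b + T * 2) * 2 ^ L)   ≡⟨ rev-+-* L (suc K) x (b + T * 2) x<2^L ⟩
        rev L x * D + rev (suc K) (b + T * 2)       ≡⟨ cong (_+_ (rev L x * D)) (rev-suc-bit K b T b<2) ⟩
        rev L x * D + (b * 2 ^ K + h)               ∎
        where open ≡-Reasoning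

      rev-next : ∀ j → j < 2 ^ L → rev k (ts (suc i) + j) ≡ rev L j * D + c
      rev-next j j<2^L = begin
        rev k (ts (suc i) + j)              ≡⟨ cong (rev k) (trans (cong (_+ j) ts-suc≡) (+-comm _ j)) ⟩
        rev k (j + (1 + T * 2) * 2 ^ L)     ≡⟨ rev-k-block j 1 j<2^L (s≤s (s≤s z≤n)) ⟩
        rev L j * D + (1 * 2 ^ K + h)       ≡⟨ cong (λ y → rev L j * D + (y + h)) (*-identityˡ (2 ^ K)) ⟩
        rev L j * D + c                     ∎
        where open ≡-Reasoning

      rev-base : ∀ x → x < 2 ^ L → rev k (x + base) ≡ rev L x * D + h
      rev-base x x<2^L = rev-k-block x 0 x<2^L (s≤s z≤n)

      ts-suc≡2^L+base : ts (suc i) ≡ 2 ^ L + base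
      ts-suc≡2^L+base = trans ts-suc≡ (split T (2 ^ L))
        where
        split : ∀ T y → (1 + T * 2) * y ≡ y + T * 2 * y
        split = solve-∀

      ts≡ : ts i ≡ w * 2 ^ l + base
      ts≡ = +-cancelʳ-≡ (2 ^ l) _ _ (begin
        ts i + 2 ^ l                ≡⟨ ts-suc≡2^L+base ⟩
        2 ^ L + base                ≡⟨ cong (_+ base) 2^L≡2^l+w*2^l ⟩
        2 ^ l + w * 2 ^ l + base    ≡⟨ rotate (2 ^ l) (w * 2 ^ l) base ⟩
        w * 2 ^ l + base + 2 ^ l    ∎)
        where
        open ≡-Reasoning
        rotate : ∀ x y z → x + y + z ≡ y + z + x
        rotate = solve-∀

      rev-prev : ∀ j → j < 2 ^ l → rev k (ts i + j) ≡ (rev l j * W + w) * D + h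
      rev-prev j j<2^l = begin
        rev k (ts i + j)                 ≡⟨ cong (rev k) (trans (cong (_+ j) ts≡) (rotate (w * 2 ^ l) base j)) ⟩
        rev k ((j + w * 2 ^ l) + base)   ≡⟨ rev-base _ offset<2^L ⟩
        rev L (j + w * 2 ^ l) * D + h    ≡⟨ cong (λ y → y * D + h) rev-offset ⟩
        (rev l j * W + w) * D + h        ∎
        where
        open ≡-Reasoning
        rotate : ∀ x y z → x + y + z ≡ z + x + y
        rotate = solve-∀
        offset<2^L : j + w * 2 ^ l < 2 ^ L
        offset<2^L = subst (j + w * 2 ^ l <_) (sym 2^L≡2^l+w*2^l) (+-monoˡ-< (w * 2 ^ l) j<2^l)
        rev-offset : rev L (j + w * 2 ^ l) ≡ rev l j * W + w
        rev-offset = begin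
          rev L (j + w * 2 ^ l)       ≡⟨ cong (λ m → rev m (j + w * 2 ^ l)) (sym (m+[n∸m]≡n (<⇒≤ l<L))) ⟩
          rev (l + d) (j + w * 2 ^ l) ≡⟨ rev-+-* l d j w j<2^l ⟩
          rev l j * W + rev d w       ≡⟨ cong (_+_ (rev l j * W)) (rev-all-ones d w suc-w≡W) ⟩
          rev l j * W + w             ∎

      s≤ts : s ≤ ts i
      s≤ts = proj₁ (ts-window i λ j j<i → ls<k j (≤-trans (<⇒≤ j<i) (n≤1+n i)))

      ts-suc<s+2^L : ts (suc i) < s + 2 ^ L
      ts-suc<s+2^L = proj₂ (ts-window (suc i) λ j j<suc-i → ls<k j (<⇒≤ j<suc-i))

      r : ℕ
      r = s ∸ base

      s≡ : s ≡ r + base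
      s≡ = sym (m∸n+n≡m (<⇒≤ base<s))
        where
        base<s : base < s
        base<s = +-cancelˡ-< (2 ^ L) base s
          (subst₂ _<_ ts-suc≡2^L+base (+-comm s (2 ^ L)) ts-suc<s+2^L)

      r<2^L : r < 2 ^ L
      r<2^L = +-cancelʳ-< base r (2 ^ L) (begin-strict
        r + base      ≡⟨ s≡ ⟨
        s             ≤⟨ s≤ts ⟩
        ts i          <⟨ m<m+n (ts i) (m^n>0 2 l) ⟩
        ts (suc i)    ≡⟨ ts-suc≡2^L+base ⟩
        2 ^ L + base  ∎)
        where open ≤-Reasoning

      rev-s : rev k s ≡ rev L r * D + h
      rev-s = trans (cong (rev k) s≡) (rev-base r r<2^L)

      *D+<2^k : ∀ {u x} → u < 2 ^ L → x < D → u * D + x < 2 ^ k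
      *D+<2^k {u} {x} u<2^L x<D = subst (u * D + x <_) 2^L*D≡2^k (*+<* u<2^L x<D)
        where
        2^L*D≡2^k : 2 ^ L * D ≡ 2 ^ k
        2^L*D≡2^k = trans (sym (^-distribˡ-+-* 2 L (suc K))) (cong (2 ^_) (sym k≡))

      h<D : h < D
      h<D = <-≤-trans (rev<2^ K T) (m≤m+n (2 ^ K) _)

      c<D : c < D
      c<D = subst (c <_) (sym (2^suc≡2^+2^ K)) (+-monoʳ-< (2 ^ K) (rev<2^ K T))

      h≤c : h ≤ c
      h≤c = m≤n+m h (2 ^ K)

      AbovePrev : ℕ → Set ℓ₂
      AbovePrev v = Above ((v * W + w) * D + h)

      prev-coord<2^L : ∀ {v} → v < 2 ^ l → v * W + w < 2 ^ L
      prev-coord<2^L {v} v<2^l = subst (v * W + w <_) (sym 2^L≡2^l*W) (*+<* v<2^l (subst (w <_) suc-w≡W ≤-refl))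

      l' : ℕ
      l' = pred (2 ^ l)

      l'<2^l : l' < 2 ^ l
      l'<2^l = subst (l' <_) (suc-pred-2^ l) ≤-refl

      AbovePrev-last : AbovePrev l'
      AbovePrev-last = Above-upward (rev k s) _ rev-s≤ (*D+<2^k (prev-coord<2^L l'<2^l) h<D) s-Above
        where
        r≤ : rev L r ≤ l' * W + w
        r≤ = m<1+n⇒m≤n (subst (rev L r <_) 2^L≡last+1 (rev<2^ L r))
          where
          2^L≡last+1 : 2 ^ L ≡ suc (l' * W + w)
          2^L≡last+1 = begin
            2 ^ L            ≡⟨ 2^L≡2^l*W ⟩
            2 ^ l * W        ≡⟨ cong (_* W) (suc-pred-2^ l) ⟨
            suc l' * W       ≡⟨ cong (_+ l' * W) (sym suc-w≡W) ⟩
            suc (w + l' * W) ≡⟨ cong suc (+-comm w (l' * W)) ⟩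
            suc (l' * W + w) ∎
            where open ≡-Reasoning
        rev-s≤ : rev k s ≤ (l' * W + w) * D + h
        rev-s≤ = subst (_≤ (l' * W + w) * D + h) (sym rev-s) (+-monoˡ-≤ h (*-monoˡ-≤ D r≤))

      AboveNext : ℕ → Set ℓ₂
      AboveNext u = Above (u * D + c)

      AboveNext-upward : UpwardClosed L AboveNext
      AboveNext-upward x y x≤y y<2^L = Above-upward _ _ (+-monoˡ-≤ c (*-monoˡ-≤ D x≤y)) (*D+<2^k y<2^L c<D)

      AboveNext-above-edge : ∀ v → v < 2 ^ l → (∀ v₀ → v ≡ suc v₀ → ¬ AbovePrev v₀) →
                             ∀ x → AboveNext x → v * W ≤ suc x
      AboveNext-above-edge zero     _      _    x _  = z≤n
      AboveNext-above-edge (suc v₀) v<2^l  edge x qx =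
        subst (_≤ suc x) (cong (_+ v₀ * W) suc-w≡W) (s≤s (subst (_≤ x) (+-comm (v₀ * W) w) edge≤x))
        where
        edge≤x : v₀ * W + w ≤ x
        edge≤x = ≮⇒≥ λ x<edge → edge v₀ refl (Above-upward _ _
          (≤-trans (<⇒≤ (*+<* x<edge c<D)) (m≤m+n _ h))
          (*D+<2^k (prev-coord<2^L (<-trans (n<1+n v₀) v<2^l)) h<D) qx)

      open Records (λ j → length (U (ts (suc i) + j))) (λ j → length-U≤1 (ts (suc i) + j))

      records : ∀ v → v < 2 ^ l → AbovePrev v → RecordsOnly L AboveNext (v * W + w)
      records v v<2^l prev-v = records-only λ j j<2^L 0<fj →
        let t       = ts (suc i) + j
            changed = U-nonempty⇒ub-changed t 0<fj
            rev-t   = rev-next j j<2^L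
        in  subst Above rev-t (proj₁ (ub-changed t changed))
          , *+-cancel-< D h≤c (subst₂ _<_ rev-t rev-tᵥ
              (change-below-earlier-Above tᵥ t s≤tᵥ (tᵥ<ts-suc j) (subst Above (sym rev-tᵥ) prev-v) changed))
          , λ j' j'<j q' → let rev-t' = rev-next j' (<-trans j'<j j<2^L) in
              *+-cancel-< D ≤-refl (subst₂ _<_ rev-t rev-t'
                (change-below-earlier-Above (ts (suc i) + j') t (s≤ts-suc+ j') (+-monoʳ-< (ts (suc i)) j'<j)
                   (subst Above (sym rev-t') q') changed))
        where
        tᵥ : ℕ
        tᵥ = ts i + rev l v
        rev-tᵥ : rev k tᵥ ≡ (v * W + w) * D + h
        rev-tᵥ = trans (rev-prev (rev l v) (rev<2^ l v))
                       (cong (λ u → (u * W + w) * D + h) (rev-involutive l v v<2^l))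
        s≤tᵥ : s ≤ tᵥ
        s≤tᵥ = ≤-trans s≤ts (m≤m+n (ts i) _)
        tᵥ<ts-suc : ∀ j → tᵥ < ts (suc i) + j
        tᵥ<ts-suc j = <-≤-trans (+-monoʳ-< (ts i) (rev<2^ l v)) (m≤m+n (ts (suc i)) j)
        s≤ts-suc+ : ∀ j → s ≤ ts (suc i) + j
        s≤ts-suc+ j = ≤-trans s≤ts (≤-trans (m≤m+n (ts i) _) (m≤m+n (ts (suc i)) j))

      count≤ : count L ≤ d ⊔ 2
      count≤ with run-start (λ v → Above? ((v * W + w) * D + h)) l' AbovePrev-last
      ... | v , v≤l' , prev-v , edge =
        count≤d⊔2-within-shifted-block L d v AboveNext (v * W + w) AboveNext-upward (records v v<2^l prev-v)
          (λ u → Above? (u * D + c)) (AboveNext-above-edge v v<2^l edge) (≤-reflexive b+1≡)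
        where
        v<2^l : v < 2 ^ l
        v<2^l = ≤-<-trans v≤l' l'<2^l
        b+1≡ : suc (v * W + w) ≡ suc v * W
        b+1≡ = trans (sym (+-suc (v * W) w)) (trans (cong (_+_ (v * W)) suc-w≡W) (+-comm (v * W) W))

      cardUnionU≤ : cardUnionU (suc i) ≤ d ⊔ 2
      cardUnionU≤ = begin
        cardUnionU (suc i)               ≤⟨ length-deduplicate ℤ._≟_ (concatMap U (Y (suc i))) ⟩
        length (concatMap U (Y (suc i))) ≡⟨ length-concatMap-upTo U (_+_ (ts (suc i))) (2 ^ L) ⟩
        count L                          ≤⟨ count≤ ⟩
        d ⊔ 2                            ∎
        where open ≤-Reasoning

lemma11 : ∀ {a ℓ₁ ℓ₂ : Level} (O : StrictTotalOrder a ℓ₁ ℓ₂)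
    (k : ℕ) (κ : ℕ → StrictTotalOrder.Carrier O)
    (κ' κ'' : StrictTotalOrder.Carrier O) (s : ℕ) →
    2 ≤ k →
    (∀ i j → i ≤ j → j < 2 ^ k → LeO O (κ i) (κ j)) →
    LeO O κ' κ'' →
    s < 2 ^ k →
    RBO.ub O k κ κ' κ'' s (suc s) ℤ.+ 1ℤ ℤ.≤ + (2 ^ k) ℤ.- 1ℤ →
    ∀ i → (∀ j → j ≤ suc i → RBO.ls O k κ κ' κ'' s j ≢ k) →
    RBO.cardUnionU O k κ κ' κ'' s (suc i)
    ≤ (RBO.ls O k κ κ' κ'' s (suc i) ∸ RBO.ls O k κ κ' κ'' s i) ⊔ 2
lemma11 O k κ κ' κ'' s _ mono κ'≤κ'' _ first-slot-changes i ls≢k =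
  Block.cardUnionU≤ i ls<k (first-slot-Above first-slot-changes)
  where
  open Receiver O k κ κ' κ'' s mono κ'≤κ''
  ls<k : ∀ j → j ≤ suc i → RBO.ls O k κ κ' κ'' s j < k
  ls<k j j≤suc-i = ≤∧≢⇒< (lmax≤ k _) (ls≢k j j≤suc-i)
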